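{- Let $k\ge1$ and $n\ge1$. The number of descending strictly $k$-Naples parking functions of length $n$ is $\frac{k+1}{n}\binom{2n}{n+k+1}$.
   Context: Parking rules: $n$ spots $1,\dots,n$; cars $c_1,\dots,c_n$ arrive in order with preferences $a_j\in[n]$; $k$-Naples rule: $c_j$ parks at $a_j$ if empty, otherwise checks spots $a_j-1,\dots,a_j-k$ (those $\ge1$) in order and parks in the first empty one, otherwise drives forward from $a_j$ and parks in the first empty spot after $a_j$ (failing if none). A preference is a $k$-Naples parking function if all cars park ($0$-Naples = ordinary parking functions); it is strictly $k$-Naples if it is $k$-Naples but not $(k-1)$-Naples. Descending means weakly decreasing. $\binom{a}{b}=0$ if $b>a$. -}

module Defs where

open import Data.Nat using (ℕ; zero; suc; _+_; _∸_; _≤_; _<_; _<ᵇ_; _≡ᵇ_)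
open import Data.Bool using (Bool; true; false; if_then_else_; not)
open import Data.List using (List; []; _∷_; _++_; map; filter; upTo)
open import Data.Bool.ListAction using (any)
open import Data.Maybe using (Maybe; just; nothing)
open import Data.Vec using (Vec; lookup; toList)
open import Data.Fin using (Fin)
import Data.Fin as F
open import Data.Product using (_×_)
open import Relation.Nullary using (¬_)

-- Spots are numbered 1..n (as natural numbers); a preference sequence of
-- length n is a vector a of naturals with 1 ≤ a_j ≤ n.

range1 : ℕ → List ℕ
range1 m = map suc (upTo m)

occupied : List ℕ → ℕ → Bool
occupied occ s = any (λ t → t ≡ᵇ s) occ

firstFree : List ℕ → List ℕ → Maybe ℕ
firstFree occ [] = nothing
firstFree occ (s ∷ ss) = if occupied occ s then firstFree occ ss else just s

-- order in which a car with preference a checks the spots under the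
-- k-Naples rule with n spots:
--   a, then a-1, ..., a-k (only those ≥ 1), then a+1, ..., n.
candidates : ℕ → ℕ → ℕ → List ℕ
candidates k n a =
  a ∷ (map (λ j → a ∸ j) (filter (λ j → j Data.Nat.<? a) (range1 k))
       ++ map (λ i → a + i) (range1 (n ∸ a)))

parkAll : ℕ → ℕ → List ℕ → List ℕ → Bool
parkAll k n occ [] = true
parkAll k n occ (a ∷ as) with firstFree occ (candidates k n a)
... | nothing = false
... | just s  = parkAll k n (s ∷ occ) as

IsPreference : (n : ℕ) → Vec ℕ n → Set
IsPreference n a = (i : Fin n) → 1 ≤ lookup a i × lookup a i ≤ n

IsNaplesPF : ℕ → (n : ℕ) → Vec ℕ n → Set
IsNaplesPF k n a = IsPreference n a × parkAll k n [] (toList a) ≡ true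
  where open import Relation.Binary.PropositionalEquality using (_≡_)

IsStrictlyNaplesPF : ℕ → (n : ℕ) → Vec ℕ n → Set
IsStrictlyNaplesPF k n a = IsNaplesPF k n a × ¬ IsNaplesPF (k ∸ 1) n a

IsDescending : (n : ℕ) → Vec ℕ n → Set
IsDescending n a = (i j : Fin n) → i F.≤ j → lookup a j ≤ lookup a i

{-# OPTIONS --safe #-}
module Submission where

-- When the preferences arrive in weakly decreasing order, every spot taken so
-- far can also be reached by the next car: with preference x under the k-Naples
-- rule the reachable spots are exactly max(1, x − k), …, n, and all earlier
-- preferences were ≥ x.  So the car parks iff the number of parked cars is less
-- than the size of that window, i.e. iff a_j ≤ n − j + 1 + k.  A descending
-- preference is therefore k-Naples iff it lies under this staircase, and strictly
-- k-Naples iff it lies under the staircase for k but not under the one for k − 1.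
-- Descending sequences of length m with entries ≤ h + 1 under the staircase for d
-- are a ballot problem: by Pascal's rule on the largest entry there are
-- C(m + h, m) − C(m + h, m + d + 1) of them.  The difference of these counts for
-- k and k − 1 is C(2n − 1, n + k) − C(2n − 1, n + k + 1), which the absorption
-- identity turns into (k + 1)/n · C(2n, n + k + 1).

open import Defs
open import Data.Nat using (ℕ; zero; suc; _+_; _*_; _∸_; _≤_; _<_; z≤n; s≤s; s≤s⁻¹)
open import Data.Nat.Properties
open import Data.Nat.Combinatorics using (_C_; nCk+nC[k+1]≡[n+1]C[k+1]; nCk≡nC[n∸k]; nCn≡1; nC1≡n)
open import Data.Nat.Combinatorics.Specification using (k>n⇒nCk≡0)
open import Data.Nat.Tactic.RingSolver using (solve-∀)
open import Data.Bool using (true; false)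
open import Data.Bool.Properties using (T-≡)
open import Data.List using (List; []; _∷_; _++_; length; map; filter; upTo)
open import Data.List.Properties using (length-++; length-map; length-upTo)
open import Data.List.Membership.Propositional using (_∈_; _∉_)
open import Data.List.Membership.Propositional.Properties
open import Data.List.Relation.Binary.Subset.Propositional using (_⊆_)
open import Data.List.Relation.Unary.Any as Any using (here; there)
open import Data.List.Relation.Unary.Any.Properties using (any⁺; any⁻)
import Data.List.Relation.Unary.All as All
import Data.List.Relation.Unary.AllPairs as AllPairs
open import Data.List.Relation.Unary.Unique.Propositional using (Unique)
import Data.List.Relation.Unary.Unique.Propositional.Properties as Unique
open import Data.Maybe using (just; nothing)
open import Data.Product using (_×_; _,_; proj₁; proj₂; ∃-syntax)
open import Data.Sum using (inj₁; inj₂)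
open import Data.Unit using (⊤; tt)
open import Data.Empty using (⊥-elim)
open import Data.Fin using (Fin; zero; suc)
open import Data.Vec using (Vec; []; _∷_; toList; lookup)
open import Data.Vec.Properties using (∷-injectiveʳ)
open import Function using (_∘_)
open import Function.Bundles using (_⇔_; mk⇔; Equivalence)
open import Function.Construct.Composition using (_⇔-∘_)
open import Function.Construct.Symmetry using (⇔-sym)
open import Relation.Binary.Definitions using (tri<; tri≈; tri>)
open import Relation.Nullary using (¬_; contradiction; yes; no; Dec; ¬?; _×-dec_)
open import Relation.Binary.PropositionalEquality

open Equivalence using (to; from)

Unique-⊆⇒length≤ : {A : Set} {xs ys : List A} → Unique xs → xs ⊆ ys → length xs ≤ length ys
Unique-⊆⇒length≤ {xs = []} _ _ = z≤n
Unique-⊆⇒length≤ {xs = x ∷ xs} {ys} (x∉xs AllPairs.∷ uxs) xs⊆ys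
  with us , vs , refl ← ∈-∃++ (xs⊆ys (here refl)) = begin
    suc (length xs)           ≤⟨ s≤s (Unique-⊆⇒length≤ uxs xs⊆us++vs) ⟩
    suc (length (us ++ vs))   ≡⟨ cong suc (length-++ us) ⟩
    suc (length us + length vs) ≡⟨ +-suc (length us) (length vs) ⟨
    length us + length (x ∷ vs) ≡⟨ length-++ us ⟨
    length (us ++ x ∷ vs)     ∎
  where
  open ≤-Reasoning
  xs⊆us++vs : xs ⊆ us ++ vs
  xs⊆us++vs y∈xs with ∈-++⁻ us (xs⊆ys (there y∈xs))
  ... | inj₁ y∈us = ∈-++⁺ˡ y∈us
  ... | inj₂ (here refl) = contradiction refl (All.lookup x∉xs y∈xs)
  ... | inj₂ (there y∈vs) = ∈-++⁺ʳ us y∈vs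

Unique-⊆⊇⇒length≡ : {A : Set} {xs ys : List A} → Unique xs → Unique ys → xs ⊆ ys → ys ⊆ xs →
  length xs ≡ length ys
Unique-⊆⊇⇒length≡ uxs uys xs⊆ys ys⊆xs =
  ≤-antisym (Unique-⊆⇒length≤ uxs xs⊆ys) (Unique-⊆⇒length≤ uys ys⊆xs)

length-filter-¬+length≡length : {A : Set} {P : A → Set} (P? : ∀ x → Dec (P x)) {xs ys : List A} →
  Unique xs → Unique ys → (∀ {v} → v ∈ ys ⇔ (v ∈ xs × P v)) →
  length (filter (¬? ∘ P?) xs) + length ys ≡ length xs
length-filter-¬+length≡length {A} P? {xs} {ys} uxs uys ys⇔ =
  trans (sym (length-++ rejected)) (Unique-⊆⊇⇒length≡ unique uxs ⊆xs ⊇xs)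
  where
  rejected : List A
  rejected = filter (¬? ∘ P?) xs
  unique : Unique (rejected ++ ys)
  unique = Unique.++⁺ (Unique.filter⁺ (¬? ∘ P?) {xs} uxs) uys
    (λ (v∈rejected , v∈ys) →
      proj₂ (∈-filter⁻ (¬? ∘ P?) {xs = xs} v∈rejected) (proj₂ (to ys⇔ v∈ys)))
  ⊆xs : rejected ++ ys ⊆ xs
  ⊆xs v∈ with ∈-++⁻ rejected v∈
  ... | inj₁ v∈rejected = proj₁ (∈-filter⁻ (¬? ∘ P?) {xs = xs} v∈rejected)
  ... | inj₂ v∈ys = proj₁ (to ys⇔ v∈ys)
  ⊇xs : xs ⊆ rejected ++ ys
  ⊇xs {v} v∈xs with P? v
  ... | yes pv = ∈-++⁺ʳ rejected (from ys⇔ (v∈xs , pv))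
  ... | no ¬pv = ∈-++⁺ˡ (∈-filter⁺ (¬? ∘ P?) v∈xs ¬pv)

interval : ℕ → ℕ → List ℕ
interval lo l = map (lo +_) (upTo l)

∈-interval⇔ : ∀ {lo l s} → s ∈ interval lo l ⇔ (lo ≤ s × s < lo + l)
∈-interval⇔ {lo} {l} {s} = mk⇔ bounds member
  where
  bounds : s ∈ interval lo l → lo ≤ s × s < lo + l
  bounds s∈ with i , i∈ , refl ← ∈-map⁻ (lo +_) s∈ = m≤m+n lo i , +-monoʳ-< lo (∈-upTo⁻ i∈)
  member : lo ≤ s × s < lo + l → s ∈ interval lo l
  member (lo≤s , s<lo+l) = subst (_∈ interval lo l) (m+[n∸m]≡n lo≤s)
    (∈-map⁺ (lo +_) (∈-upTo⁺
      (+-cancelˡ-< lo _ l (subst (_< lo + l) (sym (m+[n∸m]≡n lo≤s)) s<lo+l))))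

interval-unique : ∀ lo l → Unique (interval lo l)
interval-unique lo l = Unique.map⁺ (+-cancelˡ-≡ lo _ _) (Unique.upTo⁺ l)

length-interval : ∀ lo l → length (interval lo l) ≡ l
length-interval lo l = trans (length-map (lo +_) (upTo l)) (length-upTo l)

occupied⇔∈ : ∀ {occ s} → occupied occ s ≡ true ⇔ s ∈ occ
occupied⇔∈ {occ} {s} = mk⇔
  (Any.map (λ {t} t≡ᵇs → sym (≡ᵇ⇒≡ t s t≡ᵇs)) ∘ any⁻ _ occ ∘ from T-≡)
  (to T-≡ ∘ any⁺ _ ∘ Any.map (λ { refl → ≡⇒≡ᵇ s s refl }))

firstFree-just : ∀ occ cs {s} → firstFree occ cs ≡ just s → s ∈ cs × s ∉ occ
firstFree-just occ (c ∷ cs) eq with occupied occ c in occ-c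
... | true = let s∈cs , s∉occ = firstFree-just occ cs eq in there s∈cs , s∉occ
firstFree-just occ (c ∷ cs) refl | false =
  here refl , λ c∈occ → contradiction (trans (sym occ-c) (from occupied⇔∈ c∈occ)) λ ()

firstFree-nothing : ∀ occ cs → firstFree occ cs ≡ nothing → cs ⊆ occ
firstFree-nothing occ (c ∷ cs) eq s∈ with occupied occ c in occ-c | s∈
... | true | here refl = to occupied⇔∈ occ-c
... | true | there s∈cs = firstFree-nothing occ cs eq s∈cs
firstFree-nothing occ (c ∷ cs) () _ | false | _

∈-range1⇔ : ∀ {m j} → j ∈ range1 m ⇔ (1 ≤ j × j ≤ m)
∈-range1⇔ {m} = mk⇔ bounds member
  where
  bounds : ∀ {j} → j ∈ range1 m → 1 ≤ j × j ≤ m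
  bounds j∈ with i , i∈ , refl ← ∈-map⁻ suc j∈ = s≤s z≤n , ∈-upTo⁻ i∈
  member : ∀ {j} → 1 ≤ j × j ≤ m → j ∈ range1 m
  member {suc i} (_ , i<m) = ∈-map⁺ suc (∈-upTo⁺ i<m)

Reachable : ℕ → ℕ → ℕ → ℕ → Set
Reachable k n x s = 1 ≤ s × s ≤ n × x ≤ s + k

∈-candidates⇔ : ∀ {k n x s} → 1 ≤ x → x ≤ n → s ∈ candidates k n x ⇔ Reachable k n x s
∈-candidates⇔ {k} {n} {x} {s} 1≤x x≤n = mk⇔ reachable candidate
  where
  backward forward : List ℕ
  backward = map (x ∸_) (filter (_<? x) (range1 k))
  forward = map (x +_) (range1 (n ∸ x))

  reachable : s ∈ candidates k n x → Reachable k n x s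
  reachable (here refl) = 1≤x , x≤n , m≤m+n x k
  reachable (there s∈) with ∈-++⁻ backward s∈
  ... | inj₁ s∈back with j , j∈ , refl ← ∈-map⁻ (x ∸_) s∈back
      with j∈range , j<x ← ∈-filter⁻ (_<? x) {xs = range1 k} j∈ =
    m<n⇒0<n∸m j<x , ≤-trans (m∸n≤m x j) x≤n ,
    subst (_≤ x ∸ j + k) (m∸n+n≡m (<⇒≤ j<x))
      (+-monoʳ-≤ (x ∸ j) (proj₂ (to ∈-range1⇔ j∈range)))
  ... | inj₂ s∈fwd with i , i∈ , refl ← ∈-map⁻ (x +_) s∈fwd
      with 1≤i , i≤n∸x ← to ∈-range1⇔ i∈ =
    ≤-trans 1≤x (m≤m+n x i) , subst (x + i ≤_) (m+[n∸m]≡n x≤n) (+-monoʳ-≤ x i≤n∸x) ,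
    ≤-trans (m≤m+n x i) (m≤m+n (x + i) k)

  candidate : Reachable k n x s → s ∈ candidates k n x
  candidate (1≤s , s≤n , x≤s+k) with <-cmp s x
  ... | tri≈ _ refl _ = here refl
  ... | tri< s<x _ _ = there (∈-++⁺ˡ (subst (_∈ backward) (m∸[m∸n]≡n (<⇒≤ s<x))
        (∈-map⁺ (x ∸_) (∈-filter⁺ (_<? x) {xs = range1 k}
          (from ∈-range1⇔ (m<n⇒0<n∸m s<x , m≤n+o⇒m∸n≤o x s x≤s+k))
          (∸-monoʳ-< 1≤s (<⇒≤ s<x))))))
  ... | tri> _ _ x<s = there (∈-++⁺ʳ backward (subst (_∈ forward) (m+[n∸m]≡n (<⇒≤ x<s))
        (∈-map⁺ (x +_) (from ∈-range1⇔ (m<n⇒0<n∸m x<s , ∸-monoˡ-≤ x s≤n)))))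

-- The spots max(1, x − k), …, n: x ∸ suc k is 0 when x ≤ k and x − k − 1 otherwise.
window : ℕ → ℕ → ℕ → List ℕ
window k n x = interval (suc (x ∸ suc k)) (n ∸ (x ∸ suc k))

∈-window⇔ : ∀ {k n x s} → x ≤ n → s ∈ window k n x ⇔ Reachable k n x s
∈-window⇔ {k} {n} {x} {s} x≤n = mk⇔
  (λ s∈ → let e<s , s<end = to ∈-interval⇔ s∈ in
    ≤-trans (s≤s z≤n) e<s , s≤s⁻¹ (subst (s <_) end≡1+n s<end) , x≤s+k e<s)
  (λ { (1≤s , s≤n , x≤s+k) →
    from ∈-interval⇔ (e<s 1≤s x≤s+k , subst (s <_) (sym end≡1+n) (s≤s s≤n)) })
  where
  e : ℕ
  e = x ∸ suc k
  end≡1+n : suc e + (n ∸ e) ≡ suc n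
  end≡1+n = cong suc (m+[n∸m]≡n (≤-trans (m∸n≤m x (suc k)) x≤n))
  x≤s+k : e < s → x ≤ s + k
  x≤s+k e<s = begin
    x            ≤⟨ m≤n+m∸n x (suc k) ⟩
    suc k + e    ≡⟨ +-suc k e ⟨
    k + suc e    ≤⟨ +-monoʳ-≤ k e<s ⟩
    k + s        ≡⟨ +-comm k s ⟩
    s + k        ∎
    where open ≤-Reasoning
  e<s : 1 ≤ s → x ≤ s + k → e < s
  e<s (s≤s _) x≤s+k = m<n+o⇒m∸n<o x (suc k) (s≤s (subst (x ≤_) (+-comm s k) x≤s+k))

<-length-window⇔ : ∀ {k n x c} → x ≤ n →
  c < length (window k n x) ⇔ (c < n × c + x ≤ n + k)
<-length-window⇔ {k} {n} {x} {c} x≤n =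
  mk⇔ (to-bounds ∘ m≤o∸n⇒m+n≤o (suc c) e≤n ∘ subst (c <_) (length-interval _ _))
      (subst (c <_) (sym (length-interval _ _)) ∘ m+n≤o⇒m≤o∸n (suc c) ∘ from-bounds)
  where
  e : ℕ
  e = x ∸ suc k
  e≤n : e ≤ n
  e≤n = ≤-trans (m∸n≤m x (suc k)) x≤n
  shift : ∀ c e k → c + (suc k + e) ≡ (suc c + e) + k
  shift = solve-∀
  to-bounds : suc c + e ≤ n → c < n × c + x ≤ n + k
  to-bounds c+e<n = ≤-trans (m≤m+n (suc c) e) c+e<n , (begin
    c + x             ≤⟨ +-monoʳ-≤ c (m≤n+m∸n x (suc k)) ⟩
    c + (suc k + e)   ≡⟨ shift c e k ⟩
    (suc c + e) + k   ≤⟨ +-monoˡ-≤ k c+e<n ⟩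
    n + k             ∎)
    where open ≤-Reasoning
  from-bounds : c < n × c + x ≤ n + k → suc c + e ≤ n
  from-bounds (c<n , c+x≤n+k) with suc k ≤? x
  ... | no k≮x = subst (λ e → suc c + e ≤ n) (sym (m≤n⇒m∸n≡0 (≰⇒≥ k≮x)))
    (subst (_≤ n) (sym (+-identityʳ (suc c))) c<n)
  ... | yes k<x = +-cancelʳ-≤ k (suc c + e) n (begin
    (suc c + e) + k   ≡⟨ shift c e k ⟨
    c + (suc k + e)   ≡⟨ cong (c +_) (m+[n∸m]≡n k<x) ⟩
    c + x             ≤⟨ c+x≤n+k ⟩
    n + k             ∎)
    where open ≤-Reasoning

window-full : ∀ {k n x occ} → 1 ≤ x → x ≤ n → firstFree occ (candidates k n x) ≡ nothing →
  length (window k n x) ≤ length occ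
window-full {k} {n} {x} {occ} 1≤x x≤n found = Unique-⊆⇒length≤ (interval-unique _ _)
  (firstFree-nothing occ _ found ∘ from (∈-candidates⇔ 1≤x x≤n) ∘ to (∈-window⇔ x≤n))

window-capacity : ∀ {k n x ys} → x ≤ n → Unique ys → (∀ {t} → t ∈ ys → Reachable k n x t) →
  length ys ≤ length (window k n x)
window-capacity x≤n uys reach = Unique-⊆⇒length≤ uys (from (∈-window⇔ x≤n) ∘ reach)

+-cancelˡ-≤⇔ : ∀ {c m n x k} → c + m ≡ n → (c + x ≤ n + k ⇔ x ≤ m + k)
+-cancelˡ-≤⇔ {c} {m} {x = x} {k} refl = mk⇔
  (+-cancelˡ-≤ c x (m + k) ∘ subst (c + x ≤_) (+-assoc c m k))
  (subst (c + x ≤_) (sym (+-assoc c m k)) ∘ +-monoʳ-≤ c)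

DescendingBelow : ∀ {m} → ℕ → Vec ℕ m → Set
DescendingBelow h [] = ⊤
DescendingBelow h (x ∷ xs) = 1 ≤ x × x ≤ h × DescendingBelow x xs

-- For a vector of length n this says a_i ≤ n − i + 1 + d at every position i.
Stair : ∀ {m} → ℕ → Vec ℕ m → Set
Stair d [] = ⊤
Stair d (_∷_ {m} x xs) = x ≤ suc m + d × Stair d xs

stair? : ∀ {m} d (v : Vec ℕ m) → Dec (Stair d v)
stair? d [] = yes tt
stair? d (_∷_ {m} x v) = (x ≤? suc m + d) ×-dec stair? d v

Stair-suc : ∀ {m} d (v : Vec ℕ m) → Stair d v → Stair (suc d) v
Stair-suc d [] _ = tt
Stair-suc d (_∷_ {m} x v) (x≤ , stair) =
  ≤-trans x≤ (+-monoʳ-≤ (suc m) (n≤1+n d)) , Stair-suc d v stair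

-- The invariant: every taken spot is reachable from the last preference h, hence from each
-- later, smaller, one.
parkAll-descending⇔ : ∀ k n {m} (v : Vec ℕ m) occ h → h ≤ n → DescendingBelow h v → Unique occ →
  (∀ {s} → s ∈ occ → Reachable k n h s) → length occ + m ≡ n →
  parkAll k n occ (toList v) ≡ true ⇔ Stair k v
parkAll-descending⇔ k n [] occ h _ _ _ _ _ = mk⇔ (λ _ → tt) (λ _ → refl)
parkAll-descending⇔ k n {suc m} (x ∷ xs) occ h h≤n (1≤x , x≤h , desc) uocc reach c+m≡n
  with firstFree occ (candidates k n x) in found
... | nothing = mk⇔ (λ ()) λ (x≤ , _) →
  ⊥-elim (<⇒≱ (from (<-length-window⇔ x≤n) (c<n , from (+-cancelˡ-≤⇔ c+m≡n) x≤))
              (window-full 1≤x x≤n found))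
  where
  x≤n : x ≤ n
  x≤n = ≤-trans x≤h h≤n
  c<n : length occ < n
  c<n = subst (length occ <_) c+m≡n (m<m+n (length occ) (s≤s z≤n))
... | just s with s∈cs , s∉occ ← firstFree-just occ _ found =
  mk⇔ (λ parked → x≤ , to rest parked) (from rest ∘ proj₂)
  where
  x≤n : x ≤ n
  x≤n = ≤-trans x≤h h≤n
  uocc′ : Unique (s ∷ occ)
  uocc′ = All.tabulate (λ t∈occ s≡t → s∉occ (subst (_∈ occ) (sym s≡t) t∈occ)) AllPairs.∷ uocc
  reach′ : ∀ {t} → t ∈ s ∷ occ → Reachable k n x t
  reach′ (here refl) = to (∈-candidates⇔ 1≤x x≤n) s∈cs
  reach′ (there t∈occ) = let 1≤t , t≤n , h≤t+k = reach t∈occ in 1≤t , t≤n , ≤-trans x≤h h≤t+k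
  rest : parkAll k n (s ∷ occ) (toList xs) ≡ true ⇔ Stair k xs
  rest = parkAll-descending⇔ k n xs (s ∷ occ) x x≤n desc uocc′ reach′ (trans (sym (+-suc _ m)) c+m≡n)
  x≤ : x ≤ suc m + k
  x≤ = to (+-cancelˡ-≤⇔ c+m≡n)
    (proj₂ (to (<-length-window⇔ x≤n) (window-capacity x≤n uocc′ reach′)))

descendingBelow⇔ : ∀ {m} h (v : Vec ℕ m) →
  DescendingBelow h v ⇔ (((i : Fin m) → 1 ≤ lookup v i × lookup v i ≤ h) × IsDescending m v)
descendingBelow⇔ h [] = mk⇔ (λ _ → (λ ()) , λ ()) (λ _ → tt)
descendingBelow⇔ {suc m} h (x ∷ v) = mk⇔ split join
  where
  Entries : Set
  Entries = (i : Fin (suc m)) → 1 ≤ lookup (x ∷ v) i × lookup (x ∷ v) i ≤ h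
  split : DescendingBelow h (x ∷ v) → Entries × IsDescending (suc m) (x ∷ v)
  split (1≤x , x≤h , dv) = entry , descending
    where
    bounds : (i : Fin m) → 1 ≤ lookup v i × lookup v i ≤ x
    bounds = proj₁ (to (descendingBelow⇔ x v) dv)
    entry : Entries
    entry zero = 1≤x , x≤h
    entry (suc i) = proj₁ (bounds i) , ≤-trans (proj₂ (bounds i)) x≤h
    descending : IsDescending (suc m) (x ∷ v)
    descending zero zero _ = ≤-refl
    descending zero (suc j) _ = proj₂ (bounds j)
    descending (suc i) (suc j) (s≤s i≤j) = proj₂ (to (descendingBelow⇔ x v) dv) i j i≤j
  join : Entries × IsDescending (suc m) (x ∷ v) → DescendingBelow h (x ∷ v)
  join (bounds , desc) = proj₁ (bounds zero) , proj₂ (bounds zero) , from (descendingBelow⇔ x v)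
    ((λ i → proj₁ (bounds (suc i)) , desc zero (suc i) z≤n) ,
     λ i j i≤j → desc (suc i) (suc j) (s≤s i≤j))

naples⇔stair : ∀ k n (a : Vec ℕ n) → DescendingBelow n a → IsNaplesPF k n a ⇔ Stair k a
naples⇔stair k n a desc =
  mk⇔ (to parks ∘ proj₂) (λ stair → proj₁ (to (descendingBelow⇔ n a) desc) , from parks stair)
  where
  parks : parkAll k n [] (toList a) ≡ true ⇔ Stair k a
  parks = parkAll-descending⇔ k n a [] n ≤-refl desc AllPairs.[] (λ ()) refl

strictlyNaples⇔stair : ∀ k n (a : Vec ℕ n) →
  (IsDescending n a × IsStrictlyNaplesPF (suc k) n a) ⇔ (DescendingBelow n a × Stair (suc k) a × ¬ Stair k a)
strictlyNaples⇔stair k n a = mk⇔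
  (λ (desc , naples , ¬naples) →
    let below = from (descendingBelow⇔ n a) (proj₁ naples , desc) in
    below , to (naples⇔stair (suc k) n a below) naples , ¬naples ∘ from (naples⇔stair k n a below))
  (λ (below , stair , ¬stair) →
    proj₂ (to (descendingBelow⇔ n a) below) ,
    from (naples⇔stair (suc k) n a below) stair , ¬stair ∘ to (naples⇔stair k n a below))

stairs : (m h d : ℕ) → List (Vec ℕ m)
stairs zero h d = [] ∷ []
stairs (suc m) zero d = []
stairs (suc m) (suc h) d with suc h ≤? suc m + d
... | yes _ = stairs (suc m) h d ++ map (suc h ∷_) (stairs m (suc h) d)
... | no _ = stairs (suc m) h d

DescendingBelow-suc : ∀ {m h} (v : Vec ℕ m) → DescendingBelow h v → DescendingBelow (suc h) v
DescendingBelow-suc [] _ = tt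
DescendingBelow-suc {h = h} (x ∷ v) (1≤x , x≤h , desc) = 1≤x , ≤-trans x≤h (n≤1+n h) , desc

∈-stairs⁻ : ∀ m h d {v} → v ∈ stairs m h d → DescendingBelow h v × Stair d v
∈-stairs⁻ zero h d (here refl) = tt , tt
∈-stairs⁻ (suc m) (suc h) d v∈ with suc h ≤? suc m + d
... | no _ = let desc , stair = ∈-stairs⁻ (suc m) h d v∈ in DescendingBelow-suc _ desc , stair
... | yes fits with ∈-++⁻ (stairs (suc m) h d) v∈
...   | inj₁ v∈lower =
  let desc , stair = ∈-stairs⁻ (suc m) h d v∈lower in DescendingBelow-suc _ desc , stair
...   | inj₂ v∈top with w , w∈ , refl ← ∈-map⁻ (suc h ∷_) v∈top =
  let desc , stair = ∈-stairs⁻ m (suc h) d w∈ in (s≤s z≤n , ≤-refl , desc) , fits , stair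

∈-stairs⁺ : ∀ m h d (v : Vec ℕ m) → DescendingBelow h v → Stair d v → v ∈ stairs m h d
∈-stairs⁺ zero h d [] _ _ = here refl
∈-stairs⁺ (suc m) zero d (x ∷ v) (s≤s _ , () , _) _
∈-stairs⁺ (suc m) (suc h) d (x ∷ v) (1≤x , x≤1+h , desc) (x≤ , stair)
  with suc h ≤? suc m + d | x ≟ suc h
... | yes _ | yes refl =
  ∈-++⁺ʳ (stairs (suc m) h d) (∈-map⁺ (suc h ∷_) (∈-stairs⁺ m (suc h) d v desc stair))
... | no 1+h≰ | yes refl = contradiction x≤ 1+h≰
... | yes _ | no x≢1+h =
  ∈-++⁺ˡ (∈-stairs⁺ (suc m) h d (x ∷ v) (1≤x , s≤s⁻¹ (≤∧≢⇒< x≤1+h x≢1+h) , desc) (x≤ , stair))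
... | no _ | no x≢1+h =
  ∈-stairs⁺ (suc m) h d (x ∷ v) (1≤x , s≤s⁻¹ (≤∧≢⇒< x≤1+h x≢1+h) , desc) (x≤ , stair)

stairs-unique : ∀ m h d → Unique (stairs m h d)
stairs-unique zero h d = All.[] AllPairs.∷ AllPairs.[]
stairs-unique (suc m) zero d = AllPairs.[]
stairs-unique (suc m) (suc h) d with suc h ≤? suc m + d
... | no _ = stairs-unique (suc m) h d
... | yes _ =
  Unique.++⁺ (stairs-unique (suc m) h d) (Unique.map⁺ ∷-injectiveʳ (stairs-unique m (suc h) d)) disjoint
  where
  disjoint : ∀ {v} → ¬ (v ∈ stairs (suc m) h d × v ∈ map (suc h ∷_) (stairs m (suc h) d))
  disjoint (v∈lower , v∈top) with _ , _ , refl ← ∈-map⁻ (suc h ∷_) v∈top =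
    <-irrefl refl (proj₁ (proj₂ (proj₁ (∈-stairs⁻ (suc m) h d v∈lower))))

length-stairs-fits : ∀ m h d → suc h ≤ suc m + d →
  length (stairs (suc m) (suc h) d) ≡ length (stairs (suc m) h d) + length (stairs m (suc h) d)
length-stairs-fits m h d fits with suc h ≤? suc m + d
... | yes _ = trans (length-++ (stairs (suc m) h d))
  (cong (length (stairs (suc m) h d) +_) (length-map (suc h ∷_) (stairs m (suc h) d)))
... | no ¬fits = contradiction fits ¬fits

length-stairs-¬fits : ∀ m h d → ¬ (suc h ≤ suc m + d) →
  length (stairs (suc m) (suc h) d) ≡ length (stairs (suc m) h d)
length-stairs-¬fits m h d ¬fits with suc h ≤? suc m + d
... | yes fits = contradiction fits ¬fits
... | no _ = refl

length-stairs-1 : ∀ m d → length (stairs m 1 d) ≡ 1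
length-stairs-1 zero d = refl
length-stairs-1 (suc m) d = trans (length-stairs-fits m 0 d (s≤s z≤n)) (length-stairs-1 m d)

length-stairs-inner : ∀ m h d → h < m + d →
  length (stairs (suc m) (suc h) d) + (m + suc h) C suc (suc (m + d)) ≡ (m + suc h) C suc m →
  length (stairs m (suc (suc h)) d) + (m + suc h) C suc (m + d) ≡ (m + suc h) C m →
  length (stairs (suc m) (suc (suc h)) d) + suc (m + suc h) C suc (suc (m + d)) ≡ suc (m + suc h) C suc m
length-stairs-inner m h d fits lower top = begin
  length (stairs (suc m) (suc (suc h)) d) + suc N C suc (suc (m + d))
    ≡⟨ cong₂ _+_ (length-stairs-fits m (suc h) d (s≤s fits))
                 (sym (nCk+nC[k+1]≡[n+1]C[k+1] N (suc (m + d)))) ⟩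
  (L₁ + L₂) + (N C suc (m + d) + N C suc (suc (m + d)))
    ≡⟨ regroup L₁ L₂ (N C suc (m + d)) (N C suc (suc (m + d))) ⟩
  (L₁ + N C suc (suc (m + d))) + (L₂ + N C suc (m + d))
    ≡⟨ cong₂ _+_ lower top ⟩
  N C suc m + N C m
    ≡⟨ +-comm (N C suc m) (N C m) ⟩
  N C m + N C suc m
    ≡⟨ nCk+nC[k+1]≡[n+1]C[k+1] N m ⟩
  suc N C suc m ∎
  where
  open ≡-Reasoning
  N L₁ L₂ : ℕ
  N = m + suc h
  L₁ = length (stairs (suc m) (suc h) d)
  L₂ = length (stairs m (suc (suc h)) d)
  regroup : ∀ a b x y → (a + b) + (x + y) ≡ (a + y) + (b + x)
  regroup = solve-∀

length-stairs-boundary : ∀ m d →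
  length (stairs (suc m) (suc (m + d)) d) + (m + suc (m + d)) C suc (suc (m + d))
    ≡ (m + suc (m + d)) C suc m →
  length (stairs (suc m) (suc (suc (m + d))) d) + suc (m + suc (m + d)) C suc (suc (m + d))
    ≡ suc (m + suc (m + d)) C suc m
length-stairs-boundary m d lower = begin
  length (stairs (suc m) (suc (suc (m + d))) d) + suc N C suc (suc (m + d))
    ≡⟨ cong₂ _+_ (length-stairs-¬fits m (suc (m + d)) d (<-irrefl refl ∘ s≤s⁻¹))
                 (sym (nCk+nC[k+1]≡[n+1]C[k+1] N (suc (m + d)))) ⟩
  L₁ + (N C suc (m + d) + N C suc (suc (m + d)))
    ≡⟨ cong (λ x → L₁ + (x + N C suc (suc (m + d)))) symmetric ⟩
  L₁ + (N C m + N C suc (suc (m + d)))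
    ≡⟨ regroup L₁ (N C m) (N C suc (suc (m + d))) ⟩
  N C m + (L₁ + N C suc (suc (m + d)))
    ≡⟨ cong (N C m +_) lower ⟩
  N C m + N C suc m
    ≡⟨ nCk+nC[k+1]≡[n+1]C[k+1] N m ⟩
  suc N C suc m ∎
  where
  open ≡-Reasoning
  N L₁ : ℕ
  N = m + suc (m + d)
  L₁ = length (stairs (suc m) (suc (m + d)) d)
  symmetric : N C suc (m + d) ≡ N C m
  symmetric = trans (nCk≡nC[n∸k] (m≤n+m (suc (m + d)) m)) (cong (N C_) (m+n∸n≡m m (suc (m + d))))
  regroup : ∀ a b c → a + (b + c) ≡ b + (a + c)
  regroup = solve-∀

length-stairs : ∀ m h d → h ≤ m + d → length (stairs m (suc h) d) + (m + h) C suc (m + d) ≡ (m + h) C m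
length-stairs zero h d h≤d = cong suc (k>n⇒nCk≡0 (s≤s h≤d))
length-stairs (suc m) zero d _ = begin
  length (stairs (suc m) 1 d) + (suc m + 0) C suc (suc m + d)
    ≡⟨ cong₂ _+_ (length-stairs-1 (suc m) d) (k>n⇒nCk≡0 m+0<) ⟩
  1
    ≡⟨ nCn≡1 (suc m) ⟨
  suc m C suc m
    ≡⟨ cong (_C suc m) (+-identityʳ (suc m)) ⟨
  (suc m + 0) C suc m ∎
  where
  open ≡-Reasoning
  m+0< : suc m + 0 < suc (suc m + d)
  m+0< = s≤s (≤-trans (≤-reflexive (+-identityʳ (suc m))) (m≤m+n (suc m) d))
length-stairs (suc m) (suc h) d h<1+m+d
  with length-stairs (suc m) h d (≤-trans (n≤1+n h) h<1+m+d) | m≤n⇒m<n∨m≡n (s≤s⁻¹ h<1+m+d)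
... | lower | inj₁ h<m+d = length-stairs-inner m h d h<m+d (shift lower) (length-stairs m (suc h) d h<m+d)
  where
  shift : length (stairs (suc m) (suc h) d) + suc (m + h) C suc (suc (m + d)) ≡ suc (m + h) C suc m →
          length (stairs (suc m) (suc h) d) + (m + suc h) C suc (suc (m + d)) ≡ (m + suc h) C suc m
  shift = subst (λ N → length (stairs (suc m) (suc h) d) + N C suc (suc (m + d)) ≡ N C suc m)
    (sym (+-suc m h))
... | lower | inj₂ refl = length-stairs-boundary m d (shift lower)
  where
  shift : length (stairs (suc m) (suc (m + d)) d) + suc (m + (m + d)) C suc (suc (m + d))
            ≡ suc (m + (m + d)) C suc m →
          length (stairs (suc m) (suc (m + d)) d) + (m + suc (m + d)) C suc (suc (m + d))
            ≡ (m + suc (m + d)) C suc m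
  shift = subst (λ N → length (stairs (suc m) (suc (m + d)) d) + N C suc (suc (m + d)) ≡ N C suc m)
    (sym (+-suc m (m + d)))

[k+1]*[n+1]C[k+1]≡[n+1]*nCk : ∀ n k → suc k * (suc n C suc k) ≡ suc n * (n C k)
[k+1]*[n+1]C[k+1]≡[n+1]*nCk zero zero = refl
[k+1]*[n+1]C[k+1]≡[n+1]*nCk zero (suc k) =
  trans (cong (suc (suc k) *_) (k>n⇒nCk≡0 {1} {suc (suc k)} (s≤s (s≤s z≤n)))) (*-zeroʳ (suc (suc k)))
[k+1]*[n+1]C[k+1]≡[n+1]*nCk (suc n) zero =
  trans (*-identityˡ (suc (suc n) C 1)) (trans (nC1≡n (suc (suc n))) (sym (*-identityʳ (suc (suc n)))))
[k+1]*[n+1]C[k+1]≡[n+1]*nCk (suc n) (suc k) = begin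
  suc (suc k) * (suc (suc n) C suc (suc k))
    ≡⟨ cong (suc (suc k) *_) (nCk+nC[k+1]≡[n+1]C[k+1] (suc n) (suc k)) ⟨
  suc (suc k) * (A + B)
    ≡⟨ expand k A B ⟩
  A + suc k * A + suc (suc k) * B
    ≡⟨ cong₂ (λ x y → A + x + y) ([k+1]*[n+1]C[k+1]≡[n+1]*nCk n k)
                                  ([k+1]*[n+1]C[k+1]≡[n+1]*nCk n (suc k)) ⟩
  A + suc n * (n C k) + suc n * (n C suc k)
    ≡⟨ collect n A (n C k) (n C suc k) ⟩
  A + suc n * (n C k + n C suc k)
    ≡⟨ cong (λ x → A + suc n * x) (nCk+nC[k+1]≡[n+1]C[k+1] n k) ⟩
  suc (suc n) * A ∎
  where
  open ≡-Reasoning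
  A B : ℕ
  A = suc n C suc k
  B = suc n C suc (suc k)
  expand : ∀ k A B → suc (suc k) * (A + B) ≡ A + suc k * A + suc (suc k) * B
  expand = solve-∀
  collect : ∀ n A x y → A + suc n * x + suc n * y ≡ A + suc n * (x + y)
  collect = solve-∀

-- t stands for C(N, r) − C(N, r + 1), which is how the difference of two ballot counts arises.
ballot-identity : ∀ n j N r t → suc N ≡ n + n → suc r ≡ n + j → t + N C suc r ≡ N C r →
  n * t ≡ j * (suc N C suc r)
ballot-identity n j N r t 1+N≡2n 1+r≡n+j t+b≡a =
  sym (+-cancelˡ-≡ (n * t + n * (b + b)) (j * X) (n * t) (begin
    n * t + n * (b + b) + j * X                ≡⟨ cong (λ x → n * t + n * (b + b) + j * x) X≡t+b+b ⟩
    n * t + n * (b + b) + j * (t + b + b)      ≡⟨ expand n j t b ⟩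
    (n + j) * (t + b + b)                      ≡⟨ absorbed ⟩
    (n + n) * (t + b)                          ≡⟨ regroup n t b ⟩
    n * t + n * (b + b) + n * t                ∎))
  where
  open ≡-Reasoning
  b X : ℕ
  b = N C suc r
  X = suc N C suc r
  X≡t+b+b : X ≡ t + b + b
  X≡t+b+b = trans (sym (nCk+nC[k+1]≡[n+1]C[k+1] N r)) (cong (_+ b) (sym t+b≡a))
  absorbed : (n + j) * (t + b + b) ≡ (n + n) * (t + b)
  absorbed = subst₂ _≡_ (cong₂ _*_ 1+r≡n+j X≡t+b+b) (cong₂ _*_ 1+N≡2n (sym t+b≡a))
    ([k+1]*[n+1]C[k+1]≡[n+1]*nCk N r)
  expand : ∀ n j t b → n * t + n * (b + b) + j * (t + b + b) ≡ (n + j) * (t + b + b)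
  expand = solve-∀
  regroup : ∀ n t b → (n + n) * (t + b) ≡ n * t + n * (b + b) + n * t
  regroup = solve-∀

strictStairs : (m d : ℕ) → List (Vec ℕ m)
strictStairs m d = filter (¬? ∘ stair? d) (stairs m m (suc d))

∈-strictStairs⇔ : ∀ m d {v} →
  v ∈ strictStairs m d ⇔ (DescendingBelow m v × Stair (suc d) v × ¬ Stair d v)
∈-strictStairs⇔ m d {v} = mk⇔
  (λ v∈ → let v∈stairs , ¬stair = ∈-filter⁻ (¬? ∘ stair? d) v∈
              below , stair = ∈-stairs⁻ m m (suc d) v∈stairs in below , stair , ¬stair)
  (λ (below , stair , ¬stair) →
    ∈-filter⁺ (¬? ∘ stair? d) (∈-stairs⁺ m m (suc d) v below stair) ¬stair)

length-strictStairs : ∀ m d → length (strictStairs m d) + length (stairs m m d) ≡ length (stairs m m (suc d))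
length-strictStairs m d =
  length-filter-¬+length≡length (stair? d) (stairs-unique m m (suc d)) (stairs-unique m m d)
  (mk⇔ (λ v∈ → let below , stair = ∈-stairs⁻ m m d v∈ in
                 ∈-stairs⁺ m m (suc d) _ below (Stair-suc d _ stair) , stair)
       (λ (v∈ , stair) → ∈-stairs⁺ m m d _ (proj₁ (∈-stairs⁻ m m (suc d) v∈)) stair))

strictStairs-count : ∀ n k →
  suc n * length (strictStairs (suc n) k) ≡ (suc k + 1) * ((2 * suc n) C (suc n + suc k + 1))
strictStairs-count n k = subst₂ (λ M R → suc n * t ≡ (suc k + 1) * (M C R)) (sym 2m≡1+N) (sym m+k+2≡1+r)
  (ballot-identity m (suc k + 1) N r t (sym (+-suc m n)) 1+r≡m+k+2 t+b≡a)
  where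
  m N r t : ℕ
  m = suc n
  N = m + n
  r = m + suc k
  t = length (strictStairs m k)
  Q : ℕ → ℕ
  Q d = length (stairs m m d)
  t+b≡a : t + N C suc r ≡ N C r
  t+b≡a = +-cancelʳ-≡ (Q k) (t + N C suc r) (N C r) (begin
    t + N C suc r + Q k       ≡⟨ +-comm (t + N C suc r) (Q k) ⟩
    Q k + (t + N C suc r)     ≡⟨ +-assoc (Q k) t _ ⟨
    Q k + t + N C suc r       ≡⟨ cong (_+ N C suc r) (trans (+-comm (Q k) t) (length-strictStairs m k)) ⟩
    Q (suc k) + N C suc r     ≡⟨ length-stairs m n (suc k) (≤-trans (n≤1+n n) (m≤m+n m (suc k))) ⟩
    N C m                     ≡⟨ length-stairs m n k (≤-trans (n≤1+n n) (m≤m+n m k)) ⟨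
    Q k + N C suc (m + k)     ≡⟨ cong (λ x → Q k + N C x) (sym (+-suc m k)) ⟩
    Q k + N C r               ≡⟨ +-comm (Q k) (N C r) ⟩
    N C r + Q k               ∎)
    where open ≡-Reasoning
  2m≡1+N : 2 * m ≡ suc N
  2m≡1+N = double n
    where
    double : ∀ n → 2 * suc n ≡ suc (suc n + n)
    double = solve-∀
  m+k+2≡1+r : m + suc k + 1 ≡ suc r
  m+k+2≡1+r = +-comm (m + suc k) 1
  1+r≡m+k+2 : suc r ≡ m + (suc k + 1)
  1+r≡m+k+2 = trans (sym m+k+2≡1+r) (+-assoc m (suc k) 1)

theorem5p8 : (k n : ℕ) → 1 ≤ k → 1 ≤ n →
    ∃[ xs ] (Unique xs
      × ((a : Vec ℕ n) → (a ∈ xs) ⇔ (IsDescending n a × IsStrictlyNaplesPF k n a))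
      × n * length xs ≡ (k + 1) * ((2 * n) C (n + k + 1)))
theorem5p8 (suc k) (suc n) _ _ =
  strictStairs (suc n) k ,
  Unique.filter⁺ (¬? ∘ stair? k) (stairs-unique (suc n) (suc n) (suc k)) ,
  (λ a → ⇔-sym (strictlyNaples⇔stair k (suc n) a) ⇔-∘ ∈-strictStairs⇔ (suc n) k) ,
  strictStairs-count n k
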